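{- Let $k\geq m\geq 2$ and $n\geq \ell\geq 2$ be integers. Then $BR(B_{k,m},B_{n,\ell})=k+n-1$.
   Context: For bipartite graphs $G_1,G_2$, $BR(G_1,G_2)$ is the least integer $N$ such that every red/blue edge-coloring of the complete bipartite graph $K_{N,N}$ contains a red copy of $G_1$ or a blue copy of $G_2$. $B_{k,m}$ denotes the bistar on $k+m$ vertices: a vertex $v$ of degree $k$, a vertex $w$ adjacent to $v$ of degree $m$, and $k+m-2$ further vertices of degree $1$. -}

module Defs where

open import Data.Nat using (ℕ; _∸_; _≤_)
open import Data.Fin using (Fin)
open import Data.Bool using (Bool; true; false)
open import Data.Product using (Σ; ∃; _×_; _,_)
open import Data.Sum using (_⊎_)
open import Relation.Binary.PropositionalEquality using (_≡_; _≢_)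
open import Function.Definitions using (Injective)

Colour : Set
Colour = Bool

red blue : Colour
red = true
blue = false

-- A red/blue edge-colouring of K_{N,N}: the parts are two copies of Fin N,
-- and c i j is the colour of the edge between left vertex i and right vertex j.
Colouring : ℕ → Set
Colouring N = Fin N → Fin N → Colour

transpose : ∀ {N} → Colouring N → Colouring N
transpose c i j = c j i

-- A monochromatic (colour col) copy of the bistar B_{k,m} with the degree-k
-- centre v in the left part and the degree-m centre w in the right part:
-- edge vw, k-1 distinct further neighbours of v (right part, different from w),
-- m-1 distinct further neighbours of w (left part, different from v).
BistarLeft : ∀ {N} → Colouring N → Colour → ℕ → ℕ → Set
BistarLeft {N} c col k m =
  Σ (Fin N) λ v → Σ (Fin N) λ w → (c v w ≡ col) ×
  (Σ (Fin (k ∸ 1) → Fin N) λ A → Injective _≡_ _≡_ A ×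
      (∀ i → A i ≢ w) × (∀ i → c v (A i) ≡ col)) ×
  (Σ (Fin (m ∸ 1) → Fin N) λ B → Injective _≡_ _≡_ B ×
      (∀ j → B j ≢ v) × (∀ j → c (B j) w ≡ col))

-- A copy of B_{k,m} in colour col inside K_{N,N} (the centre v may lie in either part).
HasBistar : ∀ {N} → Colouring N → Colour → ℕ → ℕ → Set
HasBistar c col k m = BistarLeft c col k m ⊎ BistarLeft (transpose c) col k m

Arrows : ℕ → ℕ → ℕ → ℕ → ℕ → Set
Arrows N k m n l = (c : Colouring N) → HasBistar c red k m ⊎ HasBistar c blue n l

BRbistar≡ : ℕ → ℕ → ℕ → ℕ → ℕ → Set
BRbistar≡ k m n l R = Arrows R k m n l × (∀ N → Arrows N k m n l → R ≤ N)

module Submission where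

-- Write k = 1 + k' and n = 1 + n'.
--
-- Upper bound, N = k' + n.  Suppose no colour class contains a "candidate":
-- an edge vw of that colour with deg v ≥ k, deg w ≥ m (red), resp. deg v ≥ n,
-- deg w ≥ l (blue); a candidate immediately yields a bistar.  Call a vertex
-- heavy if its red degree is ≥ k, otherwise it has blue degree ≥ n.  Red edges
-- at heavy vertices end at light vertices and blue edges at light vertices end
-- at heavy ones; counting red neighbours of a heavy x and blue neighbours of a
-- light y on the same side then exceeds N, so each side is all heavy or all
-- light.  Each of the four combinations is contradictory (two directly, two by
-- double counting red edges).
--
-- Lower bound, N ≤ k' + n'.  Colour edge ij red iff (i + j mod N) < k'.  The
-- red (resp. blue) edges at a vertex get distinct labels below k' (resp. n'),
-- so no vertex has k red (n blue) edges, and a bistar B_{k,m} contains such a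
-- star.

open import Defs
open import Data.Nat using (ℕ; zero; suc; _+_; _∸_; _≤_; _<_; z≤n; s≤s; _<?_; _≤?_)
open import Data.Nat.Properties
open import Data.Fin using (Fin; zero; suc; toℕ; fromℕ<)
import Data.Fin.Properties as Fin
open import Data.Bool using (Bool; true; false; not; if_then_else_)
import Data.Bool.Properties as Bool
open import Data.Vec.Functional using (_∷_)
open import Data.Product using (∃; Σ; _×_; _,_; proj₁; proj₂)
open import Data.Sum using (_⊎_; inj₁; inj₂)
open import Data.Empty using (⊥; ⊥-elim)
open import Function using (_∘_)
open import Function.Definitions using (Injective)
open import Relation.Nullary using (¬_; Dec; yes; no; does)
open import Relation.Nullary.Decidable using (_×-dec_; dec-true; dec-false; decidable-stable)
open import Relation.Binary.PropositionalEquality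
open import Algebra.Properties.CommutativeMonoid.Sum +-0-commutativeMonoid
  using (sum; sum-cong-≗; ∑-distrib-+; ∑-comm)

decided-true : ∀ {P : Set} (d : Dec P) → does d ≡ true → P
decided-true (yes p) _ = p
decided-true (no _) ()

decided-false : ∀ {P : Set} (d : Dec P) → does d ≡ false → ¬ P
decided-false (yes _) ()
decided-false (no ¬p) _ = ¬p

sum-mono-≤ : ∀ {N} {f g : Fin N → ℕ} → (∀ i → f i ≤ g i) → sum f ≤ sum g
sum-mono-≤ {zero} _ = z≤n
sum-mono-≤ {suc N} f≤g = +-mono-≤ (f≤g zero) (sum-mono-≤ (f≤g ∘ suc))

sum-mono-< : ∀ {N} {f g : Fin N → ℕ} → Fin N → (∀ i → f i < g i) → sum f < sum g
sum-mono-< {suc N} _ f<g = +-mono-<-≤ (f<g zero) (sum-mono-≤ (<⇒≤ ∘ f<g ∘ suc))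

sum-ones : ∀ N → sum {N} (λ _ → 1) ≡ N
sum-ones zero = refl
sum-ones (suc N) = cong suc (sum-ones N)

indicator : Bool → ℕ
indicator true = 1
indicator false = 0

count : ∀ {N} → (Fin N → Bool) → ℕ
count p = sum (indicator ∘ p)

count-complement : ∀ {N} (p : Fin N → Bool) → count p + count (not ∘ p) ≡ N
count-complement {N} p = begin
  count p + count (not ∘ p)                  ≡⟨ sym (∑-distrib-+ (indicator ∘ p) (indicator ∘ not ∘ p)) ⟩
  sum (λ i → indicator (p i) + indicator (not (p i)))
                                             ≡⟨ sum-cong-≗ {N} (one-side ∘ p) ⟩
  sum {N} (λ _ → 1)                          ≡⟨ sum-ones N ⟩
  N                                                    ∎
  where
  open ≡-Reasoning
  one-side : ∀ b → indicator b + indicator (not b) ≡ 1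
  one-side true = refl
  one-side false = refl

count-mono : ∀ {N} {p q : Fin N → Bool} → (∀ i → p i ≡ true → q i ≡ true) →
  count p ≤ count q
count-mono p⇒q = sum-mono-≤ λ i → indicator-mono (p⇒q i)
  where
  indicator-mono : ∀ {a b} → (a ≡ true → b ≡ true) → indicator a ≤ indicator b
  indicator-mono {true} a⇒b rewrite a⇒b refl = ≤-refl
  indicator-mono {false} _ = z≤n

∷-injective : ∀ {n} {A : Set} {a : A} {B : Fin n → A} →
  Injective _≡_ _≡_ B → (∀ i → B i ≢ a) → Injective _≡_ _≡_ (a ∷ B)
∷-injective _ _ {zero} {zero} _ = refl
∷-injective _ fresh {zero} {suc j} e = ⊥-elim (fresh j (sym e))
∷-injective _ fresh {suc i} {zero} e = ⊥-elim (fresh i e)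
∷-injective B-inj _ {suc i} {suc j} e = cong suc (B-inj e)

Listing : ∀ {N} → (Fin N → Bool) → ℕ → Set
Listing {N} p t = Σ (Fin t → Fin N) λ A → Injective _≡_ _≡_ A × (∀ i → p (A i) ≡ true)

enumerate : ∀ {N} (p : Fin N → Bool) t → t ≤ count p → Listing p t
enumerate p zero _ = (λ ()) , (λ {i} → ⊥-elim (Fin.¬Fin0 i)) , (λ ())
enumerate {suc N} p (suc t) t<count with p zero in p₀
... | true with (A , A-inj , A-p) ← enumerate (p ∘ suc) t (≤-pred t<count) =
  zero ∷ (suc ∘ A) , ∷-injective (A-inj ∘ Fin.suc-injective) (λ _ ()) , listed A-p
  where
  listed : (∀ i → p (suc (A i)) ≡ true) → ∀ i → p ((zero ∷ (suc ∘ A)) i) ≡ true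
  listed _ zero = p₀
  listed A-p (suc i) = A-p i
... | false with (A , A-inj , A-p) ← enumerate (p ∘ suc) (suc t) t<count =
  suc ∘ A , A-inj ∘ Fin.suc-injective , A-p

remove : ∀ {N} → (Fin N → Bool) → Fin N → Fin N → Bool
remove p w j = if does (j Fin.≟ w) then false else p j

remove-sound : ∀ {N} (p : Fin N → Bool) w j → remove p w j ≡ true → p j ≡ true × j ≢ w
remove-sound p w j = unless (j Fin.≟ w)
  where
  unless : ∀ {Q : Set} (d : Dec Q) → (if does d then false else p j) ≡ true → p j ≡ true × ¬ Q
  unless (yes _) ()
  unless (no ¬q) pj = pj , ¬q

count-remove : ∀ {N} (p : Fin N → Bool) w → p w ≡ true → count p ≡ suc (count (remove p w))
count-remove {suc N} p zero pw rewrite pw = refl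
count-remove {suc N} p (suc w) pw =
  trans (cong (indicator (p zero) +_) (count-remove (p ∘ suc) w pw)) (+-suc _ _)

enumerate-avoiding : ∀ {N} (p : Fin N → Bool) w K → p w ≡ true → K ≤ count p →
  Σ (Fin (K ∸ 1) → Fin N) λ A →
    Injective _≡_ _≡_ A × (∀ i → A i ≢ w) × (∀ i → p (A i) ≡ true)
enumerate-avoiding p w K pw K≤count
  with (A , A-inj , A-p) ← enumerate (remove p w) (K ∸ 1)
         (subst (λ x → K ∸ 1 ≤ x ∸ 1) (count-remove p w pw) (∸-monoˡ-≤ 1 K≤count)) =
  A , A-inj , (proj₂ ∘ removed) , (proj₁ ∘ removed)
  where
  removed : ∀ i → p (A i) ≡ true × A i ≢ w
  removed i = remove-sound p w (A i) (A-p i)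

agrees : Colour → Bool → Bool
agrees true b = b
agrees false b = not b

agrees-complete : ∀ {col b} → b ≡ col → agrees col b ≡ true
agrees-complete {true} refl = refl
agrees-complete {false} refl = refl

agrees-sound : ∀ col b → agrees col b ≡ true → b ≡ col
agrees-sound true _ e = e
agrees-sound false false _ = refl

degree : ∀ {N} → Colouring N → Colour → Fin N → ℕ
degree c col v = count (λ j → agrees col (c v j))

some-neighbour : ∀ {N} (c : Colouring N) col v → 1 ≤ degree c col v → ∃ λ w → c v w ≡ col
some-neighbour c col v 1≤deg with (A , _ , A-col) ← enumerate _ 1 1≤deg =
  A zero , agrees-sound col _ (A-col zero)

Candidate : ∀ {N} → Colouring N → Colour → ℕ → ℕ → Set
Candidate c col K M = ∃ λ v → ∃ λ w →
  c v w ≡ col × K ≤ degree c col v × M ≤ degree (transpose c) col w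

-- Candidates are decidable, which makes the upper-bound argument constructive.
candidate? : ∀ {N} (c : Colouring N) col K M → Dec (Candidate c col K M)
candidate? c col K M = Fin.any? λ v → Fin.any? λ w →
  (c v w Bool.≟ col) ×-dec (K ≤? degree c col v) ×-dec (M ≤? degree (transpose c) col w)

candidate⇒bistar : ∀ {N} (c : Colouring N) col K M → Candidate c col K M → BistarLeft c col K M
candidate⇒bistar c col K M (v , w , vw , K≤deg-v , M≤deg-w)
  with (A , A-inj , A≢w , A-col) ← enumerate-avoiding (λ j → agrees col (c v j)) w K (agrees-complete vw) K≤deg-v
     | (B , B-inj , B≢v , B-col) ← enumerate-avoiding (λ j → agrees col (c j w)) v M (agrees-complete vw) M≤deg-w =
  v , w , vw , (A , A-inj , A≢w , λ i → agrees-sound col _ (A-col i))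
             , (B , B-inj , B≢v , λ j → agrees-sound col _ (B-col j))

no-candidate : ∀ {N} {c : Colouring N} {col K M} → ¬ Candidate c col K M →
  ∀ v w → c v w ≡ col → K ≤ degree c col v → degree (transpose c) col w < M
no-candidate {c = c} {col} {K} {M} none v w vw K≤deg with M ≤? degree (transpose c) col w
... | yes M≤deg = ⊥-elim (none (v , w , vw , K≤deg , M≤deg))
... | no M≰deg = ≰⇒> M≰deg

Star : ∀ {N} → Colouring N → Colour → Fin N → ℕ → Set
Star {N} c col v K = Σ (Fin K → Fin N) λ x → Injective _≡_ _≡_ x × (∀ i → c v (x i) ≡ col)

bistar⇒star : ∀ {N} (c : Colouring N) col K M → BistarLeft c col K M →
  ∃ λ v → Star c col v (suc (K ∸ 1))
bistar⇒star c col K M (v , w , vw , (A , A-inj , A≢w , A-col) , _) =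
  v , w ∷ A , ∷-injective A-inj A≢w , star-edges
  where
  star-edges : ∀ i → c v ((w ∷ A) i) ≡ col
  star-edges zero = vw
  star-edges (suc i) = A-col i

record Labelling {N} (c : Colouring N) (col : Colour) (B : ℕ) : Set where
  field
    label : Fin N → Fin N → ℕ
    bounded : ∀ v j → c v j ≡ col → label v j < B
    distinct : ∀ v j j' → c v j ≡ col → c v j' ≡ col → label v j ≡ label v j' → j ≡ j'

star-size-≤ : ∀ {N} {c : Colouring N} {col B v K} → Labelling c col B → Star c col v K → K ≤ B
star-size-≤ {c = c} {col} {B} {v} {K} L (x , x-inj , x-col) = Fin.injective⇒≤ g-inj
  where
  open Labelling L
  g : Fin K → Fin B
  g i = fromℕ< (bounded v (x i) (x-col i))
  g-inj : Injective _≡_ _≡_ g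
  g-inj {i} {j} gi≡gj = x-inj (distinct v (x i) (x j) (x-col i) (x-col j) (begin
    label v (x i)  ≡⟨ sym (Fin.toℕ-fromℕ< _) ⟩
    toℕ (g i)      ≡⟨ cong toℕ gi≡gj ⟩
    toℕ (g j)      ≡⟨ Fin.toℕ-fromℕ< _ ⟩
    label v (x j)  ∎))
    where open ≡-Reasoning

Symmetric : ∀ {N} → Colouring N → Set
Symmetric {N} c = ∀ (i j : Fin N) → c i j ≡ c j i

transpose-labelling : ∀ {N} {c : Colouring N} {col B} → Symmetric c →
  Labelling c col B → Labelling (transpose c) col B
transpose-labelling {c = c} c-sym L = record
  { label = label
  ; bounded = λ v j e → bounded v j (trans (c-sym v j) e)
  ; distinct = λ v j j' e e' → distinct v j j' (trans (c-sym v j) e) (trans (c-sym v j') e')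
  }
  where open Labelling L

labelling⇒no-bistar : ∀ {N} {c : Colouring N} {col B} M → Symmetric c →
  Labelling c col B → ¬ HasBistar c col (suc B) M
labelling⇒no-bistar {c = c} {col} {B} M c-sym L (inj₁ bistar)
  with (_ , star) ← bistar⇒star c col (suc B) M bistar =
  1+n≰n (star-size-≤ L star)
labelling⇒no-bistar {c = c} {col} {B} M c-sym L (inj₂ bistar)
  with (_ , star) ← bistar⇒star (transpose c) col (suc B) M bistar =
  1+n≰n (star-size-≤ (transpose-labelling c-sym L) star)

-- Reduction modulo N of a number below 2N.
wrap : ℕ → ℕ → ℕ
wrap N s with s <? N
... | yes _ = s
... | no _ = s ∸ N

wrap-< : ∀ N s → s < N + N → wrap N s < N
wrap-< N s s<2N with s <? N
... | yes s<N = s<N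
... | no s≮N = subst (s ∸ N <_) (m+n∸n≡m N N) (∸-monoˡ-< s<2N (≮⇒≥ s≮N))

overflow-below : ∀ {N} a {b} → b < N → N ≤ a + b → a + b ∸ N < a
overflow-below {N} a {b} b<N N≤a+b =
  subst (a + b ∸ N <_) (m+n∸m≡n N a)
    (∸-monoˡ-< (subst (a + b <_) (+-comm a N) (+-monoʳ-< a b<N)) N≤a+b)

wrap-injective : ∀ N a {b b'} → b < N → b' < N → wrap N (a + b) ≡ wrap N (a + b') → b ≡ b'
wrap-injective N a {b} {b'} b<N b'<N e with a + b <? N | a + b' <? N
... | yes _ | yes _ = +-cancelˡ-≡ a b b' e
... | no p | no q = +-cancelˡ-≡ a b b' (∸-cancelʳ-≡ (≮⇒≥ p) (≮⇒≥ q) e)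
... | yes _ | no q =
  ⊥-elim (≤⇒≯ (≤-trans (m≤m+n a b) (≤-reflexive e)) (overflow-below a b'<N (≮⇒≥ q)))
... | no p | yes _ =
  ⊥-elim (≤⇒≯ (≤-trans (m≤m+n a b') (≤-reflexive (sym e))) (overflow-below a b<N (≮⇒≥ p)))

position : ∀ {N} → Fin N → Fin N → ℕ
position {N} i j = wrap N (toℕ i + toℕ j)

position-< : ∀ {N} (i j : Fin N) → position i j < N
position-< {N} i j = wrap-< N _ (+-mono-< (Fin.toℕ<n i) (Fin.toℕ<n j))

position-injective : ∀ {N} (v : Fin N) {j j'} → position v j ≡ position v j' → j ≡ j'
position-injective {N} v {j} {j'} e =
  Fin.toℕ-injective (wrap-injective N (toℕ v) (Fin.toℕ<n j) (Fin.toℕ<n j') e)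

cyclic : ∀ N → ℕ → Colouring N
cyclic N k' i j = does (position i j <? k')

cyclic-symmetric : ∀ N k' → Symmetric (cyclic N k')
cyclic-symmetric N k' i j = cong (λ s → does (wrap N s <? k')) (+-comm (toℕ i) (toℕ j))

red-labelling : ∀ N k' → Labelling (cyclic N k') red k'
red-labelling N k' = record
  { label = position
  ; bounded = λ v j → decided-true (position v j <? k')
  ; distinct = λ v _ _ _ _ → position-injective v
  }

-- Blue edges have positions in [k', N), so position - k' is a label below n'.
blue-labelling : ∀ N k' n' → N ≤ k' + n' → Labelling (cyclic N k') blue n'
blue-labelling N k' n' N≤ = record
  { label = λ v j → position v j ∸ k'
  ; bounded = bounded
  ; distinct = λ v j j' e e' → position-injective v ∘ ∸-cancelʳ-≡ (k'≤ v j e) (k'≤ v j' e')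
  }
  where
  k'≤ : ∀ v j → cyclic N k' v j ≡ blue → k' ≤ position v j
  k'≤ v j e = ≮⇒≥ (decided-false (position v j <? k') e)
  bounded : ∀ v j → cyclic N k' v j ≡ blue → position v j ∸ k' < n'
  bounded v j e = subst (position v j ∸ k' <_) (m+n∸m≡n k' n')
    (∸-monoˡ-< (<-≤-trans (position-< v j) N≤) (k'≤ v j e))

-- Lower bound: if K_{N,N} arrows (B_{1+k',m}, B_{1+n',l}) then N ≥ k' + 1 + n',
-- since for N ≤ k' + n' the cyclic colouring has neither bistar.
lower-bound : ∀ N k' m n' l → Arrows N (suc k') m (suc n') l → k' + suc n' ≤ N
lower-bound N k' m n' l arrows with k' + suc n' ≤? N
... | yes ok = ok
... | no too-big with arrows (cyclic N k')
...   | inj₁ red-bistar =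
  ⊥-elim (labelling⇒no-bistar m (cyclic-symmetric N k') (red-labelling N k') red-bistar)
...   | inj₂ blue-bistar =
  ⊥-elim (labelling⇒no-bistar l (cyclic-symmetric N k') (blue-labelling N k' n' N≤) blue-bistar)
  where
  N≤ : N ≤ k' + n'
  N≤ = ≤-pred (subst (suc N ≤_) (+-suc k' n') (≰⇒> too-big))

module UpperBound (k' n m l : ℕ) (m≤k : m ≤ suc k') (l≤n : l ≤ n) (1≤n : 1 ≤ n) where

  N : ℕ
  N = k' + n

  Heavy : Colouring N → Fin N → Set
  Heavy c v = suc k' ≤ degree c red v

  heavy? : ∀ c v → Dec (Heavy c v)
  heavy? c v = suc k' ≤? degree c red v

  split : ∀ c v → degree c red v + degree c blue v ≡ N
  split c v = count-complement (c v)

  light⇒blue-rich : ∀ c v → ¬ Heavy c v → n ≤ degree c blue v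
  light⇒blue-rich c v light = +-cancelˡ-≤ k' n _ (begin
    k' + n                               ≡⟨ sym (split c v) ⟩
    degree c red v + degree c blue v     ≤⟨ +-monoˡ-≤ _ (≤-pred (≰⇒> light)) ⟩
    k' + degree c blue v                 ∎)
    where open ≤-Reasoning

  blue-poor⇒heavy : ∀ c v → degree c blue v < n → Heavy c v
  blue-poor⇒heavy c v poor = +-cancelʳ-< n k' _ (begin-strict
    k' + n                               ≡⟨ sym (split c v) ⟩
    degree c red v + degree c blue v     <⟨ +-monoʳ-< _ poor ⟩
    degree c red v + n                   ∎)
    where open ≤-Reasoning

  Homogeneous : Colouring N → Set
  Homogeneous c = (∀ v → Heavy c v) ⊎ (∀ v → ¬ Heavy c v)

  some-vertex : Fin N
  some-vertex = fromℕ< (≤-trans 1≤n (m≤n+m n k'))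

  module OneSide (c : Colouring N)
                 (no-red : ¬ Candidate c red (suc k') m)
                 (no-blue : ¬ Candidate c blue n l) where

    -- A red edge at a heavy vertex ends at a light one (red degree < m ≤ k).
    red-edge-from-heavy : ∀ v w → Heavy c v → c v w ≡ red → ¬ Heavy (transpose c) w
    red-edge-from-heavy v w heavy vw =
      <⇒≱ (<-≤-trans (no-candidate no-red v w vw heavy) m≤k)

    -- A blue edge at a light vertex ends at a heavy one (blue degree < l ≤ n).
    blue-edge-from-light : ∀ v w → ¬ Heavy c v → c v w ≡ blue → Heavy (transpose c) w
    blue-edge-from-light v w light vw = blue-poor⇒heavy (transpose c) w
      (<-≤-trans (no-candidate no-blue v w vw (light⇒blue-rich c v light)) l≤n)

    -- A heavy x and a light y would need k light plus n heavy vertices opposite.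
    no-mixed : ∀ x y → Heavy c x → ¬ Heavy c y → ⊥
    no-mixed x y heavy light = 1+n≰n (begin
      suc k' + n                    ≤⟨ +-mono-≤ (≤-trans heavy red-to-light)
                                                 (≤-trans (light⇒blue-rich c y light) blue-to-heavy) ⟩
      count (not ∘ q) + count q     ≡⟨ +-comm _ (count q) ⟩
      count q + count (not ∘ q)     ≡⟨ count-complement q ⟩
      N                             ∎)
      where
      open ≤-Reasoning
      q : Fin N → Bool
      q w = does (heavy? (transpose c) w)
      red-to-light : degree c red x ≤ count (not ∘ q)
      red-to-light = count-mono λ w xw →
        cong not (dec-false (heavy? (transpose c) w) (red-edge-from-heavy x w heavy xw))
      blue-to-heavy : degree c blue y ≤ count q
      blue-to-heavy = count-mono λ w yw →
        dec-true (heavy? (transpose c) w)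
          (blue-edge-from-light y w light (agrees-sound blue _ yw))

    homogeneous : Fin N → Homogeneous c
    homogeneous z with heavy? c z
    ... | yes z-heavy = inj₁ λ v → decidable-stable (heavy? c v)
                                     (no-mixed z v z-heavy)
    ... | no z-light = inj₂ λ v v-heavy → no-mixed v z v-heavy z-light

  -- Double counting: all heavy on one side and all light on the other is impossible.
  no-heavy-light : ∀ c → Fin N → (∀ v → Heavy c v) → (∀ w → ¬ Heavy (transpose c) w) → ⊥
  no-heavy-light c z heavy light = <-irrefl red-edges (begin-strict
    sum (degree (transpose c) red)   <⟨ sum-mono-< z (λ w → <-≤-trans (≰⇒> (light w)) (heavy w)) ⟩
    sum (degree c red)               ∎)
    where
    open ≤-Reasoning
    red-edges : sum (degree (transpose c) red) ≡ sum (degree c red)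
    red-edges = sym (∑-comm λ v w → indicator (c v w))

  no-candidate-free : ∀ c →
    ¬ Candidate c red (suc k') m → ¬ Candidate c blue n l →
    ¬ Candidate (transpose c) red (suc k') m → ¬ Candidate (transpose c) blue n l → ⊥
  no-candidate-free c red-l blue-l red-r blue-r =
    both-sides (Left.homogeneous z) (Right.homogeneous z)
    where
    module Left = OneSide c red-l blue-l
    module Right = OneSide (transpose c) red-r blue-r
    z = some-vertex
    both-sides : Homogeneous c → Homogeneous (transpose c) → ⊥
    both-sides (inj₁ heavy) (inj₁ heavy′) =
      let (w , zw) = some-neighbour c red z (≤-trans (s≤s z≤n) (heavy z))
      in Left.red-edge-from-heavy z w (heavy z) zw (heavy′ w)
    both-sides (inj₂ light) (inj₂ light′) =
      let (w , zw) = some-neighbour c blue z (≤-trans 1≤n (light⇒blue-rich c z (light z)))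
      in light′ w (Left.blue-edge-from-light z w (light z) zw)
    both-sides (inj₁ heavy) (inj₂ light′) = no-heavy-light c z heavy light′
    both-sides (inj₂ light) (inj₁ heavy′) = no-heavy-light (transpose c) z heavy′ light

  upper-bound : Arrows N (suc k') m n l
  upper-bound c with candidate? c red (suc k') m | candidate? (transpose c) red (suc k') m
                   | candidate? c blue n l | candidate? (transpose c) blue n l
  ... | yes cand | _ | _ | _ = inj₁ (inj₁ (candidate⇒bistar c red (suc k') m cand))
  ... | _ | yes cand | _ | _ = inj₁ (inj₂ (candidate⇒bistar (transpose c) red (suc k') m cand))
  ... | _ | _ | yes cand | _ = inj₂ (inj₁ (candidate⇒bistar c blue n l cand))
  ... | _ | _ | _ | yes cand = inj₂ (inj₂ (candidate⇒bistar (transpose c) blue n l cand))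
  ... | no red-l | no red-r | no blue-l | no blue-r =
    ⊥-elim (no-candidate-free c red-l blue-l red-r blue-r)

-- k + n - 1 = k' + (1 + n'): the upper bound holds there, and any arrowing N is at least that.
theorem12 : (k m n l : ℕ) → 2 ≤ m → m ≤ k → 2 ≤ l → l ≤ n →
    BRbistar≡ k m n l (k + n ∸ 1)
theorem12 (suc k') (suc (suc m')) (suc n') (suc (suc l')) (s≤s (s≤s _)) m≤k (s≤s (s≤s _)) l≤n =
  UpperBound.upper-bound k' (suc n') (suc (suc m')) (suc (suc l')) m≤k l≤n (s≤s z≤n) ,
  λ N arrows → lower-bound N k' (suc (suc m')) n' (suc (suc l')) arrows
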